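{- Let $m\in\mathbb N$, let $F$ be a set of primes, and let $x_1,x_2,\ldots,x_{(m-1)^2+1}$ be elements of $\mathbb G_F$. Then there exists a nonempty $H\subseteq\{1,2,\ldots,(m-1)^2+1\}$ such that $\sum_{n\in H}x_n\in m\cdot\mathbb G_F$.
   Context: For a set $F$ of primes, $\mathbb G_F=\{a/b: a\in\mathbb Z,\ b\in\mathbb N,\ \text{all prime factors of } b \text{ lie in } F\}$, and $m\cdot\mathbb G_F=\{m\cdot x:x\in\mathbb G_F\}$. $\mathbb N$ denotes the positive integers. -}

module Defs where

open import Data.Nat using (ℕ; NonZero)
open import Data.Nat.Divisibility using (_∣_)
open import Data.Nat.Primality using (Prime)
open import Data.Integer using (ℤ; +_)
open import Data.Rational using (ℚ; _/_; _+_; _*_; 0ℚ)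
open import Data.Bool using (true; false)
open import Data.Fin using (Fin; zero; suc)
open import Data.Fin.Subset using (Subset)
open import Data.Vec using (_∷_; [])
open import Data.Product using (Σ; _×_)
open import Relation.Binary.PropositionalEquality using (_≡_)

-- A "set of primes" F is a predicate on ℕ all of whose members are prime
-- (the primality hypothesis is stated separately in the theorem).

PrimeFactorsIn : (ℕ → Set) → ℕ → Set
PrimeFactorsIn F b = ∀ p → Prime p → p ∣ b → F p

InG : (ℕ → Set) → ℚ → Set
InG F q = Σ ℤ λ a → Σ ℕ λ b → Σ (NonZero b) λ nz →
  PrimeFactorsIn F b × (q ≡ (_/_ a b {{nz}}))

InMG : ℕ → (ℕ → Set) → ℚ → Set
InMG m F q = Σ ℚ λ y → InG F y × (q ≡ ((+ m) / 1) * y)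

sumOver : ∀ {n} → Subset n → (Fin n → ℚ) → ℚ
sumOver [] x = 0ℚ
sumOver (true ∷ H) x = x zero + sumOver H (λ i → x (suc i))
sumOver (false ∷ H) x = sumOver H (λ i → x (suc i))

module Submission where

-- Proof idea.  Fix m ≥ 1 and x₁, …, x_N ∈ 𝔾_F with N = (m-1)² + 1 ≥ m.
--
-- Write xᵢ = aᵢ / bᵢ with F-smooth bᵢ.  The product
--    D = ∏ bᵢ is again F-smooth (Euclid's lemma), and every xᵢ can be
--    rewritten as cᵢ / D with cᵢ ∈ ℤ.  Then Σ_{i∈H} xᵢ = (Σ_{i∈H} cᵢ) / D.
--  * Zero-sum lemma.  Any N ≥ m integers c₁, …, c_N contain a nonempty block
--    cₗ₊₁ + … + c_h divisible by m: two of the m + 1 prefix sums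
--    S₀, …, S_m agree modulo m (pigeonhole), and their difference is the
--    sum over the block, i.e. over the set difference of two initial segments.
--  * Conclusion.  If Σ_{i∈H} cᵢ = t·m then Σ_{i∈H} xᵢ = m · (t / D), and
--    t / D ∈ 𝔾_F because D is F-smooth.

open import Defs
open import Data.Nat using (ℕ; _∸_; _^_; _+_; _≤_)
open import Data.Nat.Primality using (Prime)
open import Data.Rational using (ℚ)
open import Data.Fin using (Fin)
open import Data.Fin.Subset using (Subset; Nonempty)
open import Data.Product using (Σ; _×_)

open import Data.Nat as ℕ using (zero; suc; NonZero; _<_; z≤n; s≤s; s<s)
import Data.Nat.Properties as ℕ
open import Data.Nat.Divisibility using (_∣_; divides; ∣1⇒≡1)
open import Data.Nat.Primality using (euclidsLemma; ¬prime[1])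
open import Data.Nat.ListAction using (product)
open import Data.Nat.ListAction.Properties using (∈⇒∣product; product≢0)
open import Data.Integer as ℤ using (ℤ; +_)
import Data.Integer.Properties as ℤ
open import Data.Integer.DivMod using (_%ℕ_; _/ℕ_; n%ℕd<d; a≡a%ℕn+[a/ℕn]*n)
open import Data.Integer.Divisibility.Signed using (divides) renaming (_∣_ to _∣ℤ_)
open import Data.Integer.Tactic.RingSolver using (solve-∀)
open import Algebra.Properties.CommutativeSemigroup ℤ.+-commutativeSemigroup using (x∙yz≈y∙xz)
open import Data.Rational using (_/_; toℚᵘ; fromℚᵘ) renaming (_+_ to _+ℚ_; _*_ to _*ℚ_)
open import Data.Rational.Properties
  using (toℚᵘ-injective; toℚᵘ-fromℚᵘ; toℚᵘ-homo-+; toℚᵘ-homo-*; fromℚᵘ-cong; /-cong; 0/n≡0)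
import Data.Rational.Unnormalised as ℚᵘ
import Data.Rational.Unnormalised.Properties as ℚᵘ
open import Data.Fin as Fin using (zero; suc; toℕ; fromℕ<)
open import Data.Fin.Properties using (pigeonhole; toℕ<n; fromℕ<-injective)
open import Data.Fin.Subset using (_─_; _⊆_; ⊥; inside)
open import Data.Fin.Subset.Properties using (⊥⊆; ⊆-refl; s⊆s; drop-∷-⊆)
open import Data.Bool using (true; false)
open import Data.Vec using (_∷_; []; here; there)
open import Data.List using (tabulate)
open import Data.List.Membership.Propositional.Properties using (∈-tabulate⁺)
open import Data.List.Relation.Unary.All using (All; []; _∷_)
import Data.List.Relation.Unary.All.Properties as All
open import Data.Product using (_,_; proj₁; proj₂; ∃₂)
open import Data.Sum using ([_,_]′)
open import Data.Empty using (⊥-elim)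
open import Relation.Binary.PropositionalEquality

-- Normalisation commutes with the field operations; this transfers
-- identities proved on unnormalised fractions to ℚ.
fromℚᵘ-homo-+ : ∀ p q → fromℚᵘ (p ℚᵘ.+ q) ≡ fromℚᵘ p +ℚ fromℚᵘ q
fromℚᵘ-homo-+ p q = toℚᵘ-injective (begin-equality
  toℚᵘ (fromℚᵘ (p ℚᵘ.+ q))              ≃⟨ toℚᵘ-fromℚᵘ (p ℚᵘ.+ q) ⟩
  p ℚᵘ.+ q                               ≃⟨ ℚᵘ.+-cong (toℚᵘ-fromℚᵘ p) (toℚᵘ-fromℚᵘ q) ⟨
  toℚᵘ (fromℚᵘ p) ℚᵘ.+ toℚᵘ (fromℚᵘ q)   ≃⟨ toℚᵘ-homo-+ (fromℚᵘ p) (fromℚᵘ q) ⟨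
  toℚᵘ (fromℚᵘ p +ℚ fromℚᵘ q)            ∎)
  where open ℚᵘ.≤-Reasoning

fromℚᵘ-homo-* : ∀ p q → fromℚᵘ (p ℚᵘ.* q) ≡ fromℚᵘ p *ℚ fromℚᵘ q
fromℚᵘ-homo-* p q = toℚᵘ-injective (begin-equality
  toℚᵘ (fromℚᵘ (p ℚᵘ.* q))              ≃⟨ toℚᵘ-fromℚᵘ (p ℚᵘ.* q) ⟩
  p ℚᵘ.* q                               ≃⟨ ℚᵘ.*-cong (toℚᵘ-fromℚᵘ p) (toℚᵘ-fromℚᵘ q) ⟨
  toℚᵘ (fromℚᵘ p) ℚᵘ.* toℚᵘ (fromℚᵘ q)   ≃⟨ toℚᵘ-homo-* (fromℚᵘ p) (fromℚᵘ q) ⟨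
  toℚᵘ (fromℚᵘ p *ℚ fromℚᵘ q)            ∎)
  where open ℚᵘ.≤-Reasoning

-- Fractions with a common denominator add numerator-wise:
-- a/n + c/n = (a·n + c·n)/(n·n) = ((a+c)·n)/(n·n) = (a+c)/n.
/-+-/ : ∀ a c n .{{_ : NonZero n}} → a / n +ℚ c / n ≡ (a ℤ.+ c) / n
/-+-/ a c n@(suc _) = begin
  a / n +ℚ c / n                               ≡⟨ fromℚᵘ-homo-+ (a ℚᵘ./ n) (c ℚᵘ./ n) ⟨
  fromℚᵘ (a ℚᵘ./ n ℚᵘ.+ c ℚᵘ./ n)              ≡⟨ cong fromℚᵘ (ℚᵘ./-cong (sym (ℤ.*-distribʳ-+ (+ n) a c)) refl) ⟩
  fromℚᵘ (((a ℤ.+ c) ℤ.* + n) ℚᵘ./ (n ℕ.* n))  ≡⟨ fromℚᵘ-cong (ℚᵘ.*-cancelʳ-/ n {a ℤ.+ c} {n}) ⟩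
  (a ℤ.+ c) / n                                ∎
  where open ≡-Reasoning

/1-*-/ : ∀ a t n .{{_ : NonZero n}} → (a / 1) *ℚ (t / n) ≡ (a ℤ.* t) / n
/1-*-/ a t n@(suc _) = begin
  (a / 1) *ℚ (t / n)                    ≡⟨ fromℚᵘ-homo-* (a ℚᵘ./ 1) (t ℚᵘ./ n) ⟨
  fromℚᵘ ((a ℤ.* t) ℚᵘ./ (1 ℕ.* n))     ≡⟨ cong fromℚᵘ (ℚᵘ./-cong {a ℤ.* t} refl (ℕ.*-identityˡ n)) ⟩
  (a ℤ.* t) / n                         ∎
  where open ≡-Reasoning

/-expand : ∀ a b D .{{_ : NonZero D}} {{_ : NonZero b}} → b ∣ D → Σ ℤ λ c → a / b ≡ c / D
/-expand a zero     D        {{_}} {{b≢0}} _ = ⊥-elim (NonZero.nonZero b≢0)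
/-expand a b@(suc _) D@(suc _) (divides zero ())
/-expand a b@(suc _) D@(suc _) (divides e@(suc _) D≡e*b) = a ℤ.* + e , (begin
  a / b                       ≡⟨ fromℚᵘ-cong (ℚᵘ.*-cancelʳ-/ e {a} {b}) ⟨
  (a ℤ.* + e) / (b ℕ.* e)     ≡⟨ /-cong {a ℤ.* + e} refl (trans (ℕ.*-comm b e) (sym D≡e*b)) ⟩
  (a ℤ.* + e) / D             ∎)
  where open ≡-Reasoning

-- A product of F-smooth numbers is F-smooth: a prime dividing a product
-- divides one of the factors.
product-smooth : ∀ F {ns} → All (PrimeFactorsIn F) ns → PrimeFactorsIn F (product ns)
product-smooth F []           p p-prime p∣1    = ⊥-elim (¬prime[1] (subst Prime (∣1⇒≡1 p∣1) p-prime))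
product-smooth F (n∈F ∷ ns∈F) p p-prime p∣n*ns =
  [ n∈F p p-prime , product-smooth F ns∈F p p-prime ]′ (euclidsLemma _ _ p-prime p∣n*ns)

record CommonDenominator (F : ℕ → Set) {N : ℕ} (x : Fin N → ℚ) : Set where
  field
    D         : ℕ
    {{D≢0}}   : NonZero D
    D-smooth  : PrimeFactorsIn F D
    numerator : Fin N → ℤ
    x≡c/D     : ∀ i → x i ≡ numerator i / D

commonDenominator : ∀ F {N} (x : Fin N → ℚ) → (∀ i → InG F (x i)) → CommonDenominator F x
commonDenominator F x x∈G = record
  { D         = D
  ; D-smooth  = product-smooth F (All.tabulate⁺ (λ i → proj₁ (proj₂ (proj₂ (proj₂ (x∈G i))))))
  ; numerator = λ i → proj₁ (expand i)
  ; x≡c/D     = λ i → trans (proj₂ (proj₂ (proj₂ (proj₂ (x∈G i))))) (proj₂ (expand i))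
  }
  where
  denominator : Fin _ → ℕ
  denominator i = proj₁ (proj₂ (x∈G i))
  denominator≢0 : ∀ i → NonZero (denominator i)
  denominator≢0 i = proj₁ (proj₂ (proj₂ (x∈G i)))
  D : ℕ
  D = product (tabulate denominator)
  instance
    D≢0 : NonZero D
    D≢0 = product≢0 (All.tabulate⁺ denominator≢0)
  expand : ∀ i → Σ ℤ λ c → (proj₁ (x∈G i) / denominator i) {{denominator≢0 i}} ≡ c / D
  expand i = /-expand (proj₁ (x∈G i)) (denominator i) D {{_}} {{denominator≢0 i}}
                      (∈⇒∣product (∈-tabulate⁺ i))

sumOverℤ : ∀ {n} → Subset n → (Fin n → ℤ) → ℤ
sumOverℤ []          c = + 0
sumOverℤ (true ∷ H)  c = c zero ℤ.+ sumOverℤ H (λ i → c (suc i))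
sumOverℤ (false ∷ H) c = sumOverℤ H (λ i → c (suc i))

sumOver-/ : ∀ {n} D .{{_ : NonZero D}} (H : Subset n) (x : Fin n → ℚ) (c : Fin n → ℤ) →
  (∀ i → x i ≡ c i / D) → sumOver H x ≡ sumOverℤ H c / D
sumOver-/ D []          x c x≡c/D = sym (0/n≡0 D)
sumOver-/ D (true ∷ H)  x c x≡c/D = begin
  x zero +ℚ sumOver H (λ i → x (suc i))           ≡⟨ cong₂ _+ℚ_ (x≡c/D zero) (sumOver-/ D H _ _ (λ i → x≡c/D (suc i))) ⟩
  c zero / D +ℚ sumOverℤ H (λ i → c (suc i)) / D  ≡⟨ /-+-/ (c zero) _ D ⟩
  (c zero ℤ.+ sumOverℤ H (λ i → c (suc i))) / D   ∎
  where open ≡-Reasoning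
sumOver-/ D (false ∷ H) x c x≡c/D = sumOver-/ D H _ _ (λ i → x≡c/D (suc i))

sumOverℤ-─ : ∀ {n} (A B : Subset n) (c : Fin n → ℤ) → B ⊆ A →
  sumOverℤ (A ─ B) c ℤ.+ sumOverℤ B c ≡ sumOverℤ A c
sumOverℤ-─ []          []          c B⊆A = refl
sumOverℤ-─ (true ∷ A)  (true ∷ B)  c B⊆A = begin
  sumOverℤ (A ─ B) c′ ℤ.+ (c zero ℤ.+ sumOverℤ B c′)  ≡⟨ x∙yz≈y∙xz (sumOverℤ (A ─ B) c′) (c zero) (sumOverℤ B c′) ⟩
  c zero ℤ.+ (sumOverℤ (A ─ B) c′ ℤ.+ sumOverℤ B c′)  ≡⟨ cong (ℤ._+_ (c zero)) (sumOverℤ-─ A B c′ (drop-∷-⊆ B⊆A)) ⟩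
  c zero ℤ.+ sumOverℤ A c′                             ∎
  where open ≡-Reasoning; c′ = λ i → c (suc i)
sumOverℤ-─ (true ∷ A)  (false ∷ B) c B⊆A = begin
  (c zero ℤ.+ sumOverℤ (A ─ B) c′) ℤ.+ sumOverℤ B c′  ≡⟨ ℤ.+-assoc (c zero) _ _ ⟩
  c zero ℤ.+ (sumOverℤ (A ─ B) c′ ℤ.+ sumOverℤ B c′)  ≡⟨ cong (ℤ._+_ (c zero)) (sumOverℤ-─ A B c′ (drop-∷-⊆ B⊆A)) ⟩
  c zero ℤ.+ sumOverℤ A c′                             ∎
  where open ≡-Reasoning; c′ = λ i → c (suc i)
sumOverℤ-─ (false ∷ A) (true ∷ B)  c B⊆A with () ← B⊆A here
sumOverℤ-─ (false ∷ A) (false ∷ B) c B⊆A = sumOverℤ-─ A B (λ i → c (suc i)) (drop-∷-⊆ B⊆A)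

initial : ∀ {n} → ℕ → Subset n
initial zero = ⊥
initial {zero}  (suc h) = []
initial {suc n} (suc h) = inside ∷ initial h

initial-mono : ∀ {n l h} → l ≤ h → initial {n} l ⊆ initial h
initial-mono {l = zero}              _         = ⊥⊆
initial-mono {zero}  {suc l} {suc h} _         = ⊆-refl
initial-mono {suc n} {suc l} {suc h} (s≤s l≤h) = s⊆s (initial-mono l≤h)

initial-gap : ∀ {n l h} → l < h → h ≤ n → Nonempty (initial {n} h ─ initial l)
initial-gap {suc n} {zero}  {suc h} _         _         = zero , here
initial-gap {suc n} {suc l} {suc h} (s<s l<h) (s≤s h≤n) with i , i∈gap ← initial-gap l<h h≤n =
  suc i , there i∈gap

sameRemainder⇒∣- : ∀ a b d .{{_ : NonZero d}} → a %ℕ d ≡ b %ℕ d → + d ∣ℤ a ℤ.- b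
sameRemainder⇒∣- a b d same = divides (qa ℤ.- qb) (begin
  a ℤ.- b                                              ≡⟨ cong₂ ℤ._-_ (a≡a%ℕn+[a/ℕn]*n a d) (a≡a%ℕn+[a/ℕn]*n b d) ⟩
  (+ r ℤ.+ qa ℤ.* + d) ℤ.- (+ (b %ℕ d) ℤ.+ qb ℤ.* + d) ≡⟨ cong (λ s → (+ r ℤ.+ qa ℤ.* + d) ℤ.- (+ s ℤ.+ qb ℤ.* + d)) (sym same) ⟩
  (+ r ℤ.+ qa ℤ.* + d) ℤ.- (+ r ℤ.+ qb ℤ.* + d)        ≡⟨ cancel (+ r) qa qb (+ d) ⟩
  (qa ℤ.- qb) ℤ.* + d                                  ∎)
  where
  open ≡-Reasoning
  r = a %ℕ d; qa = a /ℕ d; qb = b /ℕ d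
  cancel : ∀ r x y d → (r ℤ.+ x ℤ.* d) ℤ.- (r ℤ.+ y ℤ.* d) ≡ (x ℤ.- y) ℤ.* d
  cancel = solve-∀

-- Among any N ≥ m integers some nonempty subset has sum divisible by m:
-- two of the prefix sums S₀, …, S_m agree modulo m, and the block between
-- them has sum S_j − S_i.
multipleSubsetSum : ∀ m .{{_ : NonZero m}} {N} → m ≤ N → (c : Fin N → ℤ) →
  Σ (Subset N) λ H → Nonempty H × + m ∣ℤ sumOverℤ H c
multipleSubsetSum m {N} m≤N c = fromCollision (pigeonhole (ℕ.n<1+n m) residue)
  where
  prefixSum : ℕ → ℤ
  prefixSum h = sumOverℤ (initial h) c
  residue : Fin (suc m) → Fin m
  residue j = fromℕ< (n%ℕd<d (prefixSum (toℕ j)) m)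
  fromCollision : ∃₂ (λ i j → i Fin.< j × residue i ≡ residue j) →
    Σ (Subset N) λ H → Nonempty H × + m ∣ℤ sumOverℤ H c
  fromCollision (i , j , i<j , same) =
    block , initial-gap i<j j≤N , subst (+ m ∣ℤ_) block≡difference difference-divisible
    where
    Sᵢ = prefixSum (toℕ i)
    Sⱼ = prefixSum (toℕ j)
    block = initial (toℕ j) ─ initial (toℕ i)
    j≤N : toℕ j ≤ N
    j≤N = ℕ.≤-trans (ℕ.s≤s⁻¹ (toℕ<n j)) m≤N
    difference-divisible : + m ∣ℤ Sⱼ ℤ.- Sᵢ
    difference-divisible = sameRemainder⇒∣- Sⱼ Sᵢ m (fromℕ<-injective _ _ _ _ (sym same))
    split : sumOverℤ block c ℤ.+ Sᵢ ≡ Sⱼ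
    split = sumOverℤ-─ (initial (toℕ j)) (initial (toℕ i)) c (initial-mono (ℕ.<⇒≤ i<j))
    block≡difference : Sⱼ ℤ.- Sᵢ ≡ sumOverℤ block c
    block≡difference = begin
      Sⱼ ℤ.- Sᵢ                                 ≡⟨ cong (ℤ._- Sᵢ) split ⟨
      (sumOverℤ block c ℤ.+ Sᵢ) ℤ.- Sᵢ          ≡⟨ ℤ.+-assoc (sumOverℤ block c) Sᵢ (ℤ.- Sᵢ) ⟩
      sumOverℤ block c ℤ.+ (Sᵢ ℤ.- Sᵢ)          ≡⟨ cong (ℤ._+_ (sumOverℤ block c)) (ℤ.+-inverseʳ Sᵢ) ⟩
      sumOverℤ block c ℤ.+ + 0                  ≡⟨ ℤ.+-identityʳ (sumOverℤ block c) ⟩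
      sumOverℤ block c                          ∎
      where open ≡-Reasoning

m≤[m∸1]²+1 : ∀ m → m ≤ (m ∸ 1) ^ 2 + 1
m≤[m∸1]²+1 zero    = z≤n
m≤[m∸1]²+1 (suc k) = begin
  suc k     ≡⟨ ℕ.+-comm 1 k ⟩
  k + 1     ≤⟨ ℕ.+-monoˡ-≤ 1 (k≤k² k) ⟩
  k ^ 2 + 1 ∎
  where
  open ℕ.≤-Reasoning
  k≤k² : ∀ k → k ≤ k ^ 2
  k≤k² zero    = z≤n
  k≤k² (suc k) = ℕ.m≤m*n (suc k) (suc k ^ 1)

proposition4p2 : (m : ℕ) → 1 ≤ m → (F : ℕ → Set) → (∀ p → F p → Prime p) →
    (x : Fin ((m ∸ 1) ^ 2 + 1) → ℚ) → (∀ i → InG F (x i)) →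
    Σ (Subset ((m ∸ 1) ^ 2 + 1)) λ H → Nonempty H × InMG m F (sumOver H x)
proposition4p2 m 1≤m F _ x x∈G = conclude (multipleSubsetSum m (m≤[m∸1]²+1 m) numerator)
  where
  open CommonDenominator (commonDenominator F x x∈G)
  instance
    m≢0 : NonZero m
    m≢0 = ℕ.>-nonZero 1≤m
    -- the record field, made available to instance search
    D≢0′ : NonZero D
    D≢0′ = D≢0
  conclude : (Σ (Subset _) λ H → Nonempty H × + m ∣ℤ sumOverℤ H numerator) →
    Σ (Subset _) λ H → Nonempty H × InMG m F (sumOver H x)
  conclude (H , H≢∅ , divides t Σc≡t*m) = H , H≢∅ , t / D , (t , D , D≢0 , D-smooth , refl) , (begin
    sumOver H x               ≡⟨ sumOver-/ D H x numerator x≡c/D ⟩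
    sumOverℤ H numerator / D  ≡⟨ /-cong Σc≡t*m refl ⟩
    (t ℤ.* + m) / D           ≡⟨ /-cong (ℤ.*-comm t (+ m)) refl ⟩
    (+ m ℤ.* t) / D           ≡⟨ /1-*-/ (+ m) t D ⟨
    (+ m / 1) *ℚ (t / D)      ∎)
    where open ≡-Reasoning
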